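{- Let $n,\alpha$ be integers with $1\le\alpha\le n-1$. Then $f_{\sf TC}(n,\alpha)=n+1$ if $\alpha=1$; $f_{\sf TC}(n,\alpha)=2^{n-1}+1$ if $\alpha=n-1$; and \[ f_{\sf TC}(n,\alpha)=f_{\sf T}(n-1,\alpha)+f_{\sf T}(n',\alpha')\quad\text{if } 2\le\alpha\le n-2, \] where $n'=n-\lceil n/\alpha\rceil-\alpha+1$ and $\alpha'=\min(n',\alpha-1)$.
   Context: For $1\le\alpha\le n$, the Turán graph $T_{n,\alpha}$ is the disjoint union of $\alpha$ cliques whose orders sum to $n$ and differ pairwise by at most one; $f_{\sf T}(n,\alpha)$ is its number of stable sets (including the empty set). For $1\le\alpha\le n-1$, the Turán-connected graph $TC_{n,\alpha}$ is obtained from $T_{n,\alpha}$ by choosing a vertex $v$ in a clique of size $\lceil n/\alpha\rceil$ and adding $\alpha-1$ edges joining $v$ to one vertex of each of the other cliques; $f_{\sf TC}(n,\alpha)$ is its number of stable sets (including the empty set). -}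

module Defs where

open import Data.Nat using (ℕ; zero; suc; _+_; _∸_; _≟_)
open import Data.Nat.DivMod using (_/_; _%_)
open import Data.Bool using (Bool; true; false; _∧_; not)
open import Data.Fin using (Fin; toℕ)
open import Data.Fin.Subset using (Subset; inside; outside)
open import Data.Vec using (Vec; []; _∷_; lookup)
open import Data.List using (List; []; _∷_; _++_; map; allFin; filter; length)
open import Relation.Nullary.Decidable using (⌊_⌋)
open import Relation.Binary.PropositionalEquality using (_≡_)
open import Data.Bool using (T)
open import Data.Bool.Properties using (T?)

Graph : ℕ → Set
Graph n = Fin n → Fin n → Bool

allSubsets : (n : ℕ) → List (Subset n)
allSubsets zero = [] ∷ []
allSubsets (suc n) = map (outside ∷_) (allSubsets n) ++ map (inside ∷_) (allSubsets n)

allB : {A : Set} → (A → Bool) → List A → Bool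
allB p [] = true
allB p (x ∷ xs) = p x ∧ allB p xs

isStable : ∀ {n} → Graph n → Subset n → Bool
isStable {n} G S =
  allB (λ i → allB (λ j → not (lookup S i ∧ lookup S j ∧ G i j)) (allFin n)) (allFin n)

-- Number of stable sets of G (including the empty set).
numStable : ∀ {n} → Graph n → ℕ
numStable {n} G = length (filter (λ S → T? (isStable G S)) (allSubsets n))

-- Ceiling division ⌈ n / a ⌉ (for a ≥ 1; value at a = 0 is irrelevant).
ceilDiv : ℕ → ℕ → ℕ
ceilDiv n zero = zero
ceilDiv n (suc a) = (n + a) / suc a

-- Index of the clique containing vertex i in T_{n,α}: i mod α
-- (value at α = 0 is irrelevant).  The classes i mod α have sizes
-- ⌈n/α⌉ or ⌊n/α⌋, and class 0 has size ⌈n/α⌉.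
cls : ℕ → ℕ → ℕ
cls i zero = zero
cls i (suc a) = i % suc a

eqℕ : ℕ → ℕ → Bool
eqℕ a b = ⌊ a ≟ b ⌋

-- Turán graph T_{n,α}: disjoint union of α cliques of balanced sizes.
turan : (n α : ℕ) → Graph n
turan n α i j = not (eqℕ (toℕ i) (toℕ j)) ∧ eqℕ (cls (toℕ i) α) (cls (toℕ j) α)

-- Turán-connected graph TC_{n,α}: T_{n,α} plus edges joining vertex 0
-- (in clique 0, of size ⌈n/α⌉) to vertex c of clique c, for 1 ≤ c ≤ α-1.
isExtra : ℕ → ℕ → ℕ → Bool
isExtra α zero (suc c) = ⌊ suc c Data.Nat.<? α ⌋
isExtra α _ _ = false

turanConn : (n α : ℕ) → Graph n
turanConn n α i j =
  turan n α i j Data.Bool.∨ isExtra α (toℕ i) (toℕ j) Data.Bool.∨ isExtra α (toℕ j) (toℕ i)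

fT : ℕ → ℕ → ℕ
fT n α = numStable (turan n α)

fTC : ℕ → ℕ → ℕ
fTC n α = numStable (turanConn n α)

-- Every count is reduced to the following product formula.  If G is a
-- cluster graph (a disjoint union of cliques, the clique of a vertex being
-- given by a colour c), then the stable sets of G inside an allowed vertex
-- set A are obtained by choosing, independently in every clique, either
-- nothing or one allowed vertex; so their number is ∏ₖ (1 + |A ∩ clique k|).
--
-- Deleting the centre vertex 0 of TC_{n,α} leaves a cluster graph, which
-- gives, for n = (q+1)α + s + 1 with s < α,
--   f_TC(n, α) = (q+2)(q+3)^s (q+2)^(α-1-s) + (q+2)^s (q+1)^(α-1-s).
-- All three cases of the lemma follow by comparing this with the closed form
-- for f_T after computing ⌈n/α⌉ = q + 2 and n' = q(α-1) + s.

module Submission where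

open import Defs
open import Data.Nat using (ℕ; _+_; _∸_; _^_; _≤_; _⊓_)
open import Data.Product using (_×_)
open import Relation.Binary.PropositionalEquality using (_≡_)
open import Data.Nat using (zero; suc; _*_; _<_; s≤s; z≤n; _<ᵇ_; _≡ᵇ_; _≟_; _<?_)
open import Data.Nat.Properties
open import Data.Nat.DivMod
open import Data.Nat.Divisibility using (n∣m*n)
open import Data.Nat.Tactic.RingSolver using (solve-∀)
open import Data.Bool using (Bool; true; false; _∧_; _∨_; not; if_then_else_)
open import Data.Bool.Properties using (T?; ∧-zeroʳ; ∧-identityʳ; ∨-identityʳ)
open import Data.Fin using (Fin; toℕ) renaming (zero to fzero; suc to fsuc)
open import Data.Fin.Subset using (Subset; inside; outside)
open import Data.Vec using ([]; _∷_; lookup)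
open import Data.List using (List; []; _∷_; _++_; map; filter; length; tabulate; allFin)
open import Data.Product using (Σ-syntax; _,_; proj₁; proj₂)
open import Relation.Binary.PropositionalEquality
  using (refl; sym; trans; cong; cong₂; module ≡-Reasoning)
open import Relation.Nullary.Decidable using (⌊_⌋; isYes≗does)

ind : Bool → ℕ
ind true  = 1
ind false = 0

count : {A : Set} → (A → Bool) → List A → ℕ
count p []       = 0
count p (x ∷ xs) = ind (p x) + count p xs

length-filter : {A : Set} (p : A → Bool) (xs : List A) →
  length (filter (λ x → T? (p x)) xs) ≡ count p xs
length-filter p [] = refl
length-filter p (x ∷ xs) with p x
... | true  = cong suc (length-filter p xs)
... | false = length-filter p xs

count-++ : {A : Set} (p : A → Bool) (xs ys : List A) →
  count p (xs ++ ys) ≡ count p xs + count p ys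
count-++ p []       ys = refl
count-++ p (x ∷ xs) ys =
  trans (cong (ind (p x) +_) (count-++ p xs ys)) (sym (+-assoc (ind (p x)) _ _))

count-map : {A B : Set} (p : B → Bool) (f : A → B) (xs : List A) →
  count p (map f xs) ≡ count (λ x → p (f x)) xs
count-map p f []       = refl
count-map p f (x ∷ xs) = cong (ind (p (f x)) +_) (count-map p f xs)

count-cong : {A : Set} {p q : A → Bool} → (∀ x → p x ≡ q x) →
  (xs : List A) → count p xs ≡ count q xs
count-cong e []       = refl
count-cong e (x ∷ xs) = cong₂ _+_ (cong ind (e x)) (count-cong e xs)

count-guard : {A : Set} (b : Bool) (p : A → Bool) (xs : List A) →
  count (λ x → b ∧ p x) xs ≡ ind b * count p xs
count-guard true  p xs       = sym (+-identityʳ _)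
count-guard false p []       = refl
count-guard false p (x ∷ xs) = count-guard false p xs

deleteFirst : ∀ {n} → Graph (suc n) → Graph n
deleteFirst G i j = G (fsuc i) (fsuc j)

awayFromFirst : ∀ {n} → Graph (suc n) → (Fin (suc n) → Bool) → Fin n → Bool
awayFromFirst G A j = A (fsuc j) ∧ (not (G fzero (fsuc j)) ∧ not (G (fsuc j) fzero))

stableIn : ∀ n → Graph n → (Fin n → Bool) → Subset n → Bool
stableIn zero    G A []            = true
stableIn (suc n) G A (false ∷ S) = stableIn n (deleteFirst G) (λ j → A (fsuc j)) S
stableIn (suc n) G A (true ∷ S)  =
  A fzero ∧ (not (G fzero fzero) ∧ stableIn n (deleteFirst G) (awayFromFirst G A) S)

stableCount : ∀ n → Graph n → (Fin n → Bool) → ℕ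
stableCount n G A = count (stableIn n G A) (allSubsets n)

stableCount-step : ∀ n G A → stableCount (suc n) G A ≡
  stableCount n (deleteFirst G) (λ j → A (fsuc j)) +
  ind (A fzero) * (ind (not (G fzero fzero)) * stableCount n (deleteFirst G) (awayFromFirst G A))
stableCount-step n G A = begin
    count P (map (outside ∷_) Ss ++ map (inside ∷_) Ss)
  ≡⟨ count-++ P (map (outside ∷_) Ss) _ ⟩
    count P (map (outside ∷_) Ss) + count P (map (inside ∷_) Ss)
  ≡⟨ cong₂ _+_ (count-map P _ Ss) (count-map P _ Ss) ⟩
    stableCount n (deleteFirst G) (λ j → A (fsuc j)) +
    count (λ S → A fzero ∧ (not (G fzero fzero) ∧ stableIn n (deleteFirst G) (awayFromFirst G A) S)) Ss
  ≡⟨ cong (stableCount n (deleteFirst G) (λ j → A (fsuc j)) +_)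
       (trans (count-guard (A fzero) _ Ss) (cong (ind (A fzero) *_) (count-guard (not (G fzero fzero)) _ Ss))) ⟩
    stableCount n (deleteFirst G) (λ j → A (fsuc j)) +
    ind (A fzero) * (ind (not (G fzero fzero)) * stableCount n (deleteFirst G) (awayFromFirst G A)) ∎
  where
    open ≡-Reasoning
    P : Subset (suc n) → Bool
    P = stableIn (suc n) G A
    Ss : List (Subset n)
    Ss = allSubsets n

Stable : ∀ {n} → Graph n → Subset n → Set
Stable G S = ∀ i j → lookup S i ≡ true → lookup S j ≡ true → G i j ≡ false

Within : ∀ {n} → (Fin n → Bool) → Subset n → Set
Within A S = ∀ i → lookup S i ≡ true → A i ≡ true

∧-elim : ∀ a b → a ∧ b ≡ true → a ≡ true × b ≡ true
∧-elim true true e = refl , refl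

not-elim : ∀ a → not a ≡ true → a ≡ false
not-elim false e = refl

bool-ext : ∀ a b → (a ≡ true → b ≡ true) → (b ≡ true → a ≡ true) → a ≡ b
bool-ext true  true  f g = refl
bool-ext true  false f g = sym (f refl)
bool-ext false true  f g = g refl
bool-ext false false f g = refl

stableIn-sound : ∀ n G A S → stableIn n G A S ≡ true → Stable G S × Within A S
stableIn-sound zero G A [] e = (λ ()) , (λ ())
stableIn-sound (suc n) G A (false ∷ S) e = stable , within
  where
    IH : Stable (deleteFirst G) S × Within (λ j → A (fsuc j)) S
    IH = stableIn-sound n (deleteFirst G) (λ j → A (fsuc j)) S e
    stable : Stable G (false ∷ S)
    stable fzero    j        ()
    stable (fsuc i) fzero    p ()
    stable (fsuc i) (fsuc j) p q = proj₁ IH i j p q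
    within : Within A (false ∷ S)
    within fzero    ()
    within (fsuc i) p = proj₂ IH i p
stableIn-sound (suc n) G A (true ∷ S) e = stable , within
  where
    e₁ : A fzero ≡ true × not (G fzero fzero) ∧ stableIn n (deleteFirst G) (awayFromFirst G A) S ≡ true
    e₁ = ∧-elim (A fzero) _ e
    e₂ : not (G fzero fzero) ≡ true × stableIn n (deleteFirst G) (awayFromFirst G A) S ≡ true
    e₂ = ∧-elim (not (G fzero fzero)) _ (proj₂ e₁)
    IH : Stable (deleteFirst G) S × Within (awayFromFirst G A) S
    IH = stableIn-sound n (deleteFirst G) (awayFromFirst G A) S (proj₂ e₂)
    away : ∀ j → lookup S j ≡ true →
      A (fsuc j) ≡ true × (not (G fzero (fsuc j)) ≡ true × not (G (fsuc j) fzero) ≡ true)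
    away j p = let (a , b) = ∧-elim _ _ (proj₂ IH j p) in a , ∧-elim _ _ b
    stable : Stable G (true ∷ S)
    stable fzero    fzero    p q = not-elim _ (proj₁ e₂)
    stable fzero    (fsuc j) p q = not-elim _ (proj₁ (proj₂ (away j q)))
    stable (fsuc i) fzero    p q = not-elim _ (proj₂ (proj₂ (away i p)))
    stable (fsuc i) (fsuc j) p q = proj₁ IH i j p q
    within : Within A (true ∷ S)
    within fzero    p = proj₁ e₁
    within (fsuc i) p = proj₁ (away i p)

stableIn-complete : ∀ n G A S → Stable G S → Within A S → stableIn n G A S ≡ true
stableIn-complete zero G A [] st wi = refl
stableIn-complete (suc n) G A (false ∷ S) st wi =
  stableIn-complete n (deleteFirst G) (λ j → A (fsuc j)) S
    (λ i j → st (fsuc i) (fsuc j)) (λ i → wi (fsuc i))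
stableIn-complete (suc n) G A (true ∷ S) st wi
  rewrite wi fzero refl | st fzero fzero refl refl =
  stableIn-complete n (deleteFirst G) (awayFromFirst G A) S (λ i j → st (fsuc i) (fsuc j)) away
  where
    away : Within (awayFromFirst G A) S
    away i p rewrite wi (fsuc i) p | st fzero (fsuc i) refl p | st (fsuc i) fzero p refl = refl

-- allB over a tabulated list holds iff the test holds at every entry
-- (allFin n is tabulate id).
allB-sound : ∀ {A : Set} n (p : A → Bool) (f : Fin n → A) →
  allB p (tabulate f) ≡ true → ∀ i → p (f i) ≡ true
allB-sound (suc n) p f e fzero    = proj₁ (∧-elim _ _ e)
allB-sound (suc n) p f e (fsuc i) = allB-sound n p (λ j → f (fsuc j)) (proj₂ (∧-elim _ _ e)) i

allB-complete : ∀ {A : Set} n (p : A → Bool) (f : Fin n → A) →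
  (∀ i → p (f i) ≡ true) → allB p (tabulate f) ≡ true
allB-complete zero    p f h = refl
allB-complete (suc n) p f h rewrite h fzero = allB-complete n p (λ j → f (fsuc j)) (λ i → h (fsuc i))

-- For each pair i, j, isStable tests  not (i ∈ S ∧ j ∈ S ∧ i ~ j).
no-edge-sound : ∀ a b c → not (a ∧ b ∧ c) ≡ true → a ≡ true → b ≡ true → c ≡ false
no-edge-sound true true false e p q = refl

no-edge-complete : ∀ a b c → (a ≡ true → b ≡ true → c ≡ false) → not (a ∧ b ∧ c) ≡ true
no-edge-complete true  true  c h rewrite h refl refl = refl
no-edge-complete true  false c h = refl
no-edge-complete false b     c h = refl

isStable≡stableIn : ∀ n (G : Graph n) S → isStable G S ≡ stableIn n G (λ _ → true) S
isStable≡stableIn n G S = bool-ext _ _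
  (λ e → stableIn-complete n G _ S
     (λ i j → no-edge-sound _ _ _ (allB-sound n _ _ (allB-sound n _ _ e i) j)) (λ _ _ → refl))
  (λ e → allB-complete n _ _ (λ i → allB-complete n _ _ (λ j →
     no-edge-complete _ _ _ (proj₁ (stableIn-sound n G _ S e) i j))))

numStable≡stableCount : ∀ n (G : Graph n) → numStable G ≡ stableCount n G (λ _ → true)
numStable≡stableCount n G =
  trans (length-filter _ (allSubsets n)) (count-cong (isStable≡stableIn n G) (allSubsets n))

prod : ℕ → (ℕ → ℕ) → ℕ
prod zero    f = 1
prod (suc B) f = f 0 * prod B (λ k → f (suc k))

prod-cong : ∀ B {f g : ℕ → ℕ} → (∀ k → k < B → f k ≡ g k) → prod B f ≡ prod B g
prod-cong zero    e = refl
prod-cong (suc B) e = cong₂ _*_ (e 0 (s≤s z≤n)) (prod-cong B (λ k p → e (suc k) (s≤s p)))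

prod-const : ∀ B c → prod B (λ _ → c) ≡ c ^ B
prod-const zero    c = refl
prod-const (suc B) c = cong (c *_) (prod-const B c)

*-left-comm : ∀ a b c → a * (b * c) ≡ b * (a * c)
*-left-comm = solve-∀

except : ℕ → (ℕ → ℕ) → ℕ → ℕ
except x h k = if x ≡ᵇ k then 1 else h k

prod-split : ∀ B x → x < B → (h : ℕ → ℕ) → prod B h ≡ h x * prod B (except x h)
prod-split (suc B) zero    p       h = cong (h 0 *_) (sym (+-identityʳ _))
prod-split (suc B) (suc x) (s≤s p) h = begin
    h 0 * prod B (λ k → h (suc k))
  ≡⟨ cong (h 0 *_) (prod-split B x p (λ k → h (suc k))) ⟩
    h 0 * (h (suc x) * prod B (except x (λ k → h (suc k))))
  ≡⟨ *-left-comm (h 0) (h (suc x)) _ ⟩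
    h (suc x) * (h 0 * prod B (except x (λ k → h (suc k)))) ∎
  where
    open ≡-Reasoning

except-cong : ∀ B x {f g : ℕ → ℕ} → (∀ k → (x ≡ᵇ k) ≡ false → f k ≡ g k) →
  prod B (except x f) ≡ prod B (except x g)
except-cong B x {f} {g} e = prod-cong B (λ k _ → away k (x ≡ᵇ k) refl)
  where
    away : ∀ k b → (x ≡ᵇ k) ≡ b → (if b then 1 else f k) ≡ (if b then 1 else g k)
    away k true  _  = refl
    away k false eq = e k eq

countFin : ∀ n → (Fin n → Bool) → ℕ
countFin zero    P = 0
countFin (suc n) P = ind (P fzero) + countFin n (λ i → P (fsuc i))

countFin-cong : ∀ n {P Q : Fin n → Bool} → (∀ i → P i ≡ Q i) → countFin n P ≡ countFin n Q
countFin-cong zero    e = refl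
countFin-cong (suc n) e = cong₂ _+_ (cong ind (e fzero)) (countFin-cong n (λ i → e (fsuc i)))

countFin-false : ∀ n → countFin n (λ _ → false) ≡ 0
countFin-false zero    = refl
countFin-false (suc n) = countFin-false n

≡ᵇ-refl : ∀ x → (x ≡ᵇ x) ≡ true
≡ᵇ-refl zero    = refl
≡ᵇ-refl (suc x) = ≡ᵇ-refl x

≡ᵇ-true : ∀ x y → (x ≡ᵇ y) ≡ true → x ≡ y
≡ᵇ-true zero    zero    e = refl
≡ᵇ-true (suc x) (suc y) e = cong suc (≡ᵇ-true x y e)

≡ᵇ-sym : ∀ x y → (x ≡ᵇ y) ≡ (y ≡ᵇ x)
≡ᵇ-sym zero    zero    = refl
≡ᵇ-sym zero    (suc y) = refl
≡ᵇ-sym (suc x) zero    = refl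
≡ᵇ-sym (suc x) (suc y) = ≡ᵇ-sym x y

IsCluster : ∀ {n} → Graph n → (Fin n → ℕ) → Set
IsCluster G c = ∀ i j → G i j ≡ not (toℕ i ≡ᵇ toℕ j) ∧ (c i ≡ᵇ c j)

clique-away : ∀ a x y k →
  (a ∧ (not (x ≡ᵇ y) ∧ not (y ≡ᵇ x))) ∧ (y ≡ᵇ k) ≡ (if x ≡ᵇ k then false else a ∧ (y ≡ᵇ k))
clique-away a x y k with y ≡ᵇ k in y=k
... | false = outside-k (x ≡ᵇ k)
  where
    outside-k : ∀ b → (a ∧ (not (x ≡ᵇ y) ∧ not (y ≡ᵇ x))) ∧ false ≡ (if b then false else a ∧ false)
    outside-k true  = ∧-zeroʳ _
    outside-k false = trans (∧-zeroʳ _) (sym (∧-zeroʳ a))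
... | true with ≡ᵇ-true y k y=k
... | refl rewrite ≡ᵇ-sym y x with x ≡ᵇ y
...   | true  = cong (_∧ true) (∧-zeroʳ a)
...   | false = ∧-identityʳ (a ∧ true)

-- Adding an allowed (a) vertex of colour x < B to a cluster graph whose
-- cliques have Oₖ allowed vertices: the stable sets avoiding it, plus those
-- containing it (where clique x contributes nothing else, Oₖ′ = 0), give
-- the product formula with Oₓ increased by one.
add-vertex : ∀ (a : Bool) x B (O O′ : ℕ → ℕ) → x < B →
  (∀ k → O′ k ≡ (if x ≡ᵇ k then 0 else O k)) →
  prod B (λ k → suc (O k)) + ind a * prod B (λ k → suc (O′ k)) ≡
  prod B (λ k → suc (ind (a ∧ (x ≡ᵇ k)) + O k))
add-vertex false x B O O′ x<B e = +-identityʳ _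
add-vertex true  x B O O′ x<B e = begin
    prod B (λ k → suc (O k)) + 1 * prod B (λ k → suc (O′ k))
  ≡⟨ cong₂ (λ u v → u + 1 * v) (prod-split B x x<B _) (prod-split B x x<B _) ⟩
    suc (O x) * prod B (except x (λ k → suc (O k))) +
    1 * (suc (O′ x) * prod B (except x (λ k → suc (O′ k))))
  ≡⟨ cong₂ (λ u v → suc (O x) * R + 1 * (suc u * v)) O′x≡0 (except-cong B x O′≡O) ⟩
    suc (O x) * R + 1 * (1 * R)
  ≡⟨ merge (O x) R ⟩
    suc (suc (O x)) * R
  ≡⟨ cong₂ (λ b v → suc (ind b + O x) * v) (sym (≡ᵇ-refl x)) (except-cong B x (λ k eq → cong (λ b → suc (ind b + O k)) (sym eq))) ⟩
    suc (ind (x ≡ᵇ x) + O x) * prod B (except x (λ k → suc (ind (x ≡ᵇ k) + O k)))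
  ≡⟨ sym (prod-split B x x<B _) ⟩
    prod B (λ k → suc (ind (x ≡ᵇ k) + O k)) ∎
  where
    open ≡-Reasoning
    R : ℕ
    R = prod B (except x (λ k → suc (O k)))
    O′x≡0 : O′ x ≡ 0
    O′x≡0 = trans (e x) (cong (λ b → if b then 0 else O x) (≡ᵇ-refl x))
    O′≡O : ∀ k → (x ≡ᵇ k) ≡ false → suc (O′ k) ≡ suc (O k)
    O′≡O k eq = cong suc (trans (e k) (cong (λ b → if b then 0 else O k) eq))
    merge : ∀ o r → suc o * r + 1 * (1 * r) ≡ suc (suc o) * r
    merge = solve-∀

cluster-formula : ∀ n (G : Graph n) (c : Fin n → ℕ) B → (∀ i → c i < B) → IsCluster G c →
  ∀ A → stableCount n G A ≡ prod B (λ k → suc (countFin n (λ i → A i ∧ (c i ≡ᵇ k))))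
cluster-formula zero G c B c<B cl A = sym (trans (prod-const B 1) (^-zeroˡ B))
cluster-formula (suc n) G c B c<B cl A = begin
    stableCount (suc n) G A
  ≡⟨ stableCount-step n G A ⟩
    stableCount n G⁻ (λ j → A (fsuc j)) +
    ind (A fzero) * (ind (not (G fzero fzero)) * stableCount n G⁻ (awayFromFirst G A))
  ≡⟨ cong (λ g → stableCount n G⁻ (λ j → A (fsuc j)) + ind (A fzero) * (ind (not g) * stableCount n G⁻ (awayFromFirst G A))) (cl fzero fzero) ⟩
    stableCount n G⁻ (λ j → A (fsuc j)) + ind (A fzero) * (1 * stableCount n G⁻ (awayFromFirst G A))
  ≡⟨ cong₂ (λ u v → u + ind (A fzero) * v) (IH (λ j → A (fsuc j))) (trans (*-identityˡ _) (IH (awayFromFirst G A))) ⟩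
    prod B (λ k → suc (O k)) + ind (A fzero) * prod B (λ k → suc (O′ k))
  ≡⟨ add-vertex (A fzero) (c fzero) B O O′ (c<B fzero) O′≡ ⟩
    prod B (λ k → suc (countFin (suc n) (λ i → A i ∧ (c i ≡ᵇ k)))) ∎
  where
    open ≡-Reasoning
    G⁻ : Graph n
    G⁻ = deleteFirst G
    IH : ∀ A′ → stableCount n G⁻ A′ ≡ prod B (λ k → suc (countFin n (λ i → A′ i ∧ (c (fsuc i) ≡ᵇ k))))
    IH = cluster-formula n G⁻ (λ i → c (fsuc i)) B (λ i → c<B (fsuc i)) (λ i j → cl (fsuc i) (fsuc j))
    O O′ : ℕ → ℕ
    O  k = countFin n (λ i → A (fsuc i) ∧ (c (fsuc i) ≡ᵇ k))
    O′ k = countFin n (λ i → awayFromFirst G A i ∧ (c (fsuc i) ≡ᵇ k))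
    O′≡ : ∀ k → O′ k ≡ (if c fzero ≡ᵇ k then 0 else O k)
    O′≡ k = trans (countFin-cong n pointwise) (by-cases (c fzero ≡ᵇ k))
      where
        pointwise : ∀ i → awayFromFirst G A i ∧ (c (fsuc i) ≡ᵇ k) ≡
          (if c fzero ≡ᵇ k then false else A (fsuc i) ∧ (c (fsuc i) ≡ᵇ k))
        pointwise i rewrite cl fzero (fsuc i) | cl (fsuc i) fzero =
          clique-away (A (fsuc i)) (c fzero) (c (fsuc i)) k
        by-cases : ∀ b → countFin n (λ i → if b then false else A (fsuc i) ∧ (c (fsuc i) ≡ᵇ k)) ≡
          (if b then 0 else O k)
        by-cases true  = countFin-false n
        by-cases false = refl

countBelow : ℕ → (ℕ → Bool) → ℕ
countBelow zero    P = 0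
countBelow (suc m) P = ind (P 0) + countBelow m (λ x → P (suc x))

countFin-toℕ : ∀ m (P : ℕ → Bool) → countFin m (λ i → P (toℕ i)) ≡ countBelow m P
countFin-toℕ zero    P = refl
countFin-toℕ (suc m) P = cong (ind (P 0) +_) (countFin-toℕ m (λ x → P (suc x)))

countBelow-+ : ∀ p L (P : ℕ → Bool) →
  countBelow (p + L) P ≡ countBelow p P + countBelow L (λ y → P (p + y))
countBelow-+ zero    L P = refl
countBelow-+ (suc p) L P =
  trans (cong (ind (P 0) +_) (countBelow-+ p L (λ x → P (suc x)))) (sym (+-assoc (ind (P 0)) _ _))

countBelow-cong : ∀ m {P Q : ℕ → Bool} → (∀ x → x < m → P x ≡ Q x) → countBelow m P ≡ countBelow m Q
countBelow-cong zero    e = refl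
countBelow-cong (suc m) e = cong₂ _+_ (cong ind (e 0 (s≤s z≤n))) (countBelow-cong m (λ x p → e (suc x) (s≤s p)))

countBelow-false : ∀ m → countBelow m (λ _ → false) ≡ 0
countBelow-false zero    = refl
countBelow-false (suc m) = countBelow-false m

countBelow-≡ᵇ : ∀ r k → countBelow r (λ x → x ≡ᵇ k) ≡ ind (k <ᵇ r)
countBelow-≡ᵇ zero    k       = refl
countBelow-≡ᵇ (suc r) zero    = cong suc (countBelow-false r)
countBelow-≡ᵇ (suc r) (suc k) = countBelow-≡ᵇ r k

first-period : ∀ a r k → r ≤ suc a → countBelow r (λ x → x % suc a ≡ᵇ k) ≡ ind (k <ᵇ r)
first-period a r k r≤α = trans
  (countBelow-cong r (λ x x<r → cong (_≡ᵇ k) (m<n⇒m%n≡m (<-≤-trans x<r r≤α))))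
  (countBelow-≡ᵇ r k)

residue-shift : ∀ a y k → ((suc a + y) % suc a ≡ᵇ k) ≡ (y % suc a ≡ᵇ k)
residue-shift a y k = cong (_≡ᵇ k) (trans (cong (_% suc a) (+-comm (suc a) y)) ([m+n]%n≡m%n y (suc a)))

residue-count : ∀ a q r k → k < suc a → r ≤ suc a →
  countBelow (q * suc a + r) (λ x → x % suc a ≡ᵇ k) ≡ q + ind (k <ᵇ r)
residue-count a zero    r k k<α r≤α = first-period a r k r≤α
residue-count a (suc q) r k k<α r≤α = begin
    countBelow ((suc a + q * suc a) + r) P
  ≡⟨ cong (λ t → countBelow t P) (+-assoc (suc a) (q * suc a) r) ⟩
    countBelow (suc a + (q * suc a + r)) P
  ≡⟨ countBelow-+ (suc a) _ P ⟩
    countBelow (suc a) P + countBelow (q * suc a + r) (λ y → P (suc a + y))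
  ≡⟨ cong₂ _+_ (trans (first-period a (suc a) k ≤-refl) (cong ind (<ᵇ-true k<α)))
       (trans (countBelow-cong (q * suc a + r) {P = λ y → P (suc a + y)} (λ y _ → residue-shift a y k)) (residue-count a q r k k<α r≤α)) ⟩
    suc (q + ind (k <ᵇ r)) ∎
  where
    open ≡-Reasoning
    P : ℕ → Bool
    P x = x % suc a ≡ᵇ k
    <ᵇ-true : ∀ {x y} → x < y → (x <ᵇ y) ≡ true
    <ᵇ-true (s≤s z≤n)       = refl
    <ᵇ-true (s≤s (s≤s x<y)) = <ᵇ-true (s≤s x<y)

beyond-first-period : ∀ a L k →
  countBelow (suc a + L) (λ x → (a <ᵇ x) ∧ (x % suc a ≡ᵇ k)) ≡ countBelow L (λ x → x % suc a ≡ᵇ k)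
beyond-first-period a L k = begin
    countBelow (suc a + L) P
  ≡⟨ countBelow-+ (suc a) L P ⟩
    countBelow (suc a) P + countBelow L (λ y → P (suc a + y))
  ≡⟨ cong₂ _+_ (trans (countBelow-cong (suc a) (λ x x<α → cong (_∧ (x % suc a ≡ᵇ k)) (<ᵇ-false (≤-pred x<α)))) (countBelow-false (suc a)))
       (countBelow-cong L (λ y _ → trans (cong (_∧ ((suc a + y) % suc a ≡ᵇ k)) (<ᵇ-true a y)) (residue-shift a y k))) ⟩
    countBelow L (λ x → x % suc a ≡ᵇ k) ∎
  where
    open ≡-Reasoning
    P : ℕ → Bool
    P x = (a <ᵇ x) ∧ (x % suc a ≡ᵇ k)
    <ᵇ-false : ∀ {x a} → x ≤ a → (a <ᵇ x) ≡ false
    <ᵇ-false z≤n       = refl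
    <ᵇ-false (s≤s x≤a) = <ᵇ-false x≤a
    <ᵇ-true : ∀ a y → (a <ᵇ suc (a + y)) ≡ true
    <ᵇ-true zero    y = refl
    <ᵇ-true (suc a) y = <ᵇ-true a y

prod-balanced : ∀ α r c → r ≤ α → prod α (λ k → c + ind (k <ᵇ r)) ≡ suc c ^ r * c ^ (α ∸ r)
prod-balanced zero    zero    c z≤n       = refl
prod-balanced (suc α) zero    c z≤n       = begin
    (c + 0) * prod α (λ k → c + 0)
  ≡⟨ cong₂ _*_ (+-identityʳ c) (prod-balanced α zero c z≤n) ⟩
    c * (1 * c ^ α)
  ≡⟨ cong (c *_) (*-identityˡ (c ^ α)) ⟩
    c * c ^ α
  ≡⟨ sym (*-identityˡ (c * c ^ α)) ⟩
    1 * (c * c ^ α) ∎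
  where open ≡-Reasoning
prod-balanced (suc α) (suc r) c (s≤s r≤α) = begin
    (c + 1) * prod α (λ k → c + ind (k <ᵇ r))
  ≡⟨ cong₂ _*_ (+-comm c 1) (prod-balanced α r c r≤α) ⟩
    suc c * (suc c ^ r * c ^ (α ∸ r))
  ≡⟨ sym (*-assoc (suc c) (suc c ^ r) (c ^ (α ∸ r))) ⟩
    suc c * suc c ^ r * c ^ (α ∸ r) ∎
  where open ≡-Reasoning

eqℕ≡ᵇ : ∀ x y → eqℕ x y ≡ (x ≡ᵇ y)
eqℕ≡ᵇ x y = isYes≗does (x ≟ y)

turan-cluster : ∀ m a → IsCluster (turan m (suc a)) (λ i → toℕ i % suc a)
turan-cluster m a i j =
  cong₂ (λ u v → not u ∧ v) (eqℕ≡ᵇ (toℕ i) (toℕ j)) (eqℕ≡ᵇ (toℕ i % suc a) (toℕ j % suc a))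

fT-classes : ∀ m a → fT m (suc a) ≡ prod (suc a) (λ k → suc (countBelow m (λ x → x % suc a ≡ᵇ k)))
fT-classes m a = begin
    numStable (turan m (suc a))
  ≡⟨ numStable≡stableCount m (turan m (suc a)) ⟩
    stableCount m (turan m (suc a)) (λ _ → true)
  ≡⟨ cluster-formula m _ (λ i → toℕ i % suc a) (suc a) (λ i → m%n<n (toℕ i) (suc a)) (turan-cluster m a) _ ⟩
    prod (suc a) (λ k → suc (countFin m (λ i → toℕ i % suc a ≡ᵇ k)))
  ≡⟨ prod-cong (suc a) (λ k _ → cong suc (countFin-toℕ m (λ x → x % suc a ≡ᵇ k))) ⟩
    prod (suc a) (λ k → suc (countBelow m (λ x → x % suc a ≡ᵇ k))) ∎
  where open ≡-Reasoning

-- f_T(Qα + r, α) = (Q+2)^r (Q+1)^(α-r)  for r ≤ α: the Turán graph has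
-- r cliques of size Q+1 and α-r cliques of size Q.
fT-formula : ∀ α Q r → r ≤ α → fT (Q * α + r) α ≡ (2 + Q) ^ r * (1 + Q) ^ (α ∸ r)
fT-formula zero    Q zero z≤n rewrite *-zeroʳ Q = refl
fT-formula (suc a) Q r r≤α = begin
    fT (Q * suc a + r) (suc a)
  ≡⟨ fT-classes (Q * suc a + r) a ⟩
    prod (suc a) (λ k → suc (countBelow (Q * suc a + r) (λ x → x % suc a ≡ᵇ k)))
  ≡⟨ prod-cong (suc a) (λ k k<α → cong suc (residue-count a Q r k k<α r≤α)) ⟩
    prod (suc a) (λ k → suc Q + ind (k <ᵇ r))
  ≡⟨ prod-balanced (suc a) r (suc Q) r≤α ⟩
    (2 + Q) ^ r * (1 + Q) ^ (suc a ∸ r) ∎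
  where open ≡-Reasoning

TC-tail-cluster : ∀ m a →
  IsCluster (deleteFirst (turanConn (suc m) (suc a))) (λ i → suc (toℕ i) % suc a)
TC-tail-cluster m a i j = trans (∨-identityʳ _) (turan-cluster (suc m) a (fsuc i) (fsuc j))

-- The vertices of TC other than 0 that are not adjacent to 0: those outside
-- the clique of 0 (residue ≠ 0) and beyond 1, …, α-1 (the extra edges).
TC-away-from-0 : ∀ m a j → awayFromFirst (turanConn (suc m) (suc a)) (λ _ → true) j ≡
  not (suc (toℕ j) % suc a ≡ᵇ 0) ∧ (a <ᵇ suc (toℕ j))
TC-away-from-0 m a j =
  trans (neither (eqℕ 0 c) (eqℕ c 0) ⌊ suc (toℕ j) <? suc a ⌋ same-clique)
        (cong₂ _∧_ (cong not (eqℕ≡ᵇ c 0)) (trans (cong not (isYes≗does (suc (toℕ j) <? suc a))) (not-<ᵇ (toℕ j) a)))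
  where
    c : ℕ
    c = suc (toℕ j) % suc a
    same-clique : eqℕ 0 c ≡ eqℕ c 0
    same-clique = trans (eqℕ≡ᵇ 0 c) (trans (≡ᵇ-sym 0 c) (sym (eqℕ≡ᵇ c 0)))
    neither : ∀ e e′ l → e ≡ e′ → not (e ∨ (l ∨ false)) ∧ not (e′ ∨ (false ∨ l)) ≡ not e′ ∧ not l
    neither false .false false refl = refl
    neither false .false true  refl = refl
    neither true  .true  l     refl = refl
    not-<ᵇ : ∀ x a → not (x <ᵇ a) ≡ (a <ᵇ suc x)
    not-<ᵇ zero    zero    = refl
    not-<ᵇ zero    (suc a) = refl
    not-<ᵇ (suc x) zero    = refl
    not-<ᵇ (suc x) (suc a) = not-<ᵇ x a

inClique : ℕ → ℕ → ℕ → Bool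
inClique a k x = suc x % suc a ≡ᵇ k

awayInClique : ℕ → ℕ → ℕ → Bool
awayInClique a k x = (not (suc x % suc a ≡ᵇ 0) ∧ (a <ᵇ suc x)) ∧ inClique a k x

-- Deleting vertex 0 of TC_{m+1,α}: stable sets avoiding 0 are those of a
-- cluster graph on 1, …, m; stable sets containing 0 are those of the same
-- cluster graph inside the non-neighbours of 0.
fTC-split : ∀ m a → fTC (suc m) (suc a) ≡
  prod (suc a) (λ k → suc (countBelow m (inClique a k))) +
  prod (suc a) (λ k → suc (countBelow m (awayInClique a k)))
fTC-split m a = begin
    numStable TC
  ≡⟨ numStable≡stableCount (suc m) TC ⟩
    stableCount (suc m) TC all
  ≡⟨ stableCount-step m TC all ⟩
    stableCount m TC⁻ all + 1 * (1 * stableCount m TC⁻ (awayFromFirst TC all))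
  ≡⟨ cong₂ (λ u v → u + 1 * v) (classes all) (trans (*-identityˡ _) (classes (awayFromFirst TC all))) ⟩
    prod (suc a) (λ k → suc (countFin m (λ i → true ∧ (c i ≡ᵇ k)))) +
    1 * prod (suc a) (λ k → suc (countFin m (λ i → awayFromFirst TC all i ∧ (c i ≡ᵇ k))))
  ≡⟨ cong₂ _+_ (prod-cong (suc a) (λ k _ → cong suc (countFin-toℕ m (inClique a k))))
       (trans (*-identityˡ _) (prod-cong (suc a) (λ k _ → cong suc (away-classes k)))) ⟩
    prod (suc a) (λ k → suc (countBelow m (inClique a k))) +
    prod (suc a) (λ k → suc (countBelow m (awayInClique a k))) ∎
  where
    open ≡-Reasoning
    TC : Graph (suc m)
    TC = turanConn (suc m) (suc a)
    TC⁻ : Graph m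
    TC⁻ = deleteFirst TC
    all : ∀ {n} → Fin n → Bool
    all _ = true
    c : Fin m → ℕ
    c i = suc (toℕ i) % suc a
    classes : ∀ A → stableCount m TC⁻ A ≡ prod (suc a) (λ k → suc (countFin m (λ i → A i ∧ (c i ≡ᵇ k))))
    classes = cluster-formula m TC⁻ c (suc a) (λ i → m%n<n (suc (toℕ i)) (suc a)) (TC-tail-cluster m a)
    away-classes : ∀ k → countFin m (λ i → awayFromFirst TC all i ∧ (c i ≡ᵇ k)) ≡ countBelow m (awayInClique a k)
    away-classes k = trans (countFin-cong m (λ i → cong (_∧ (c i ≡ᵇ k)) (TC-away-from-0 m a i)))
      (countFin-toℕ m (awayInClique a k))

-- f_TC(n, α) for n = (q+1)α + s + 1 with s < α: the cliques of T_{n,α} minus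
-- vertex 0 have sizes q+1 (clique of 0) and q+1+[k ≤ s] (k = 1, …, α-1);
-- removing also the neighbours of 0 empties the clique of 0 and removes one
-- vertex from each other clique.
fTC-formula : ∀ q a s → s ≤ a → fTC (suc q * suc a + suc s) (suc a) ≡
  (2 + q) * ((3 + q) ^ s * (2 + q) ^ (a ∸ s)) + (2 + q) ^ s * (1 + q) ^ (a ∸ s)
fTC-formula q a s s≤a = begin
    fTC (suc m) (suc a)
  ≡⟨ fTC-split m a ⟩
    prod (suc a) (λ k → suc (countBelow m (inClique a k))) +
    prod (suc a) (λ k → suc (countBelow m (awayInClique a k)))
  ≡⟨ cong₂ _+_ avoiding-0 containing-0 ⟩
    (2 + q) * ((3 + q) ^ s * (2 + q) ^ (a ∸ s)) + (2 + q) ^ s * (1 + q) ^ (a ∸ s) ∎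
  where
    open ≡-Reasoning
    m : ℕ
    m = a + q * suc a + suc s
    occurrences : ∀ k → k < suc a → countBelow (suc m) (λ x → x % suc a ≡ᵇ k) ≡ suc q + ind (k <ᵇ suc s)
    occurrences k k<α = residue-count a (suc q) (suc s) k k<α (s≤s s≤a)
    avoiding-0 : prod (suc a) (λ k → suc (countBelow m (inClique a k))) ≡
      (2 + q) * ((3 + q) ^ s * (2 + q) ^ (a ∸ s))
    avoiding-0 = cong₂ _*_ (trans (occurrences 0 (s≤s z≤n)) (+-comm (suc q) 1))
      (trans (prod-cong a (λ k k<a → cong suc (occurrences (suc k) (s≤s k<a)))) (prod-balanced a s (2 + q) s≤a))
    -- the non-neighbours of 0 miss clique 0, and in clique k > 0 they are the
    -- vertices x ≥ α, whose residues repeat those of 0, …, qα + s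
    not-0 : ∀ c b → (not (c ≡ᵇ 0) ∧ b) ∧ (c ≡ᵇ 0) ≡ false
    not-0 zero    b = refl
    not-0 (suc c) b = ∧-zeroʳ b
    not-0-suc : ∀ c b k → (not (c ≡ᵇ 0) ∧ b) ∧ (c ≡ᵇ suc k) ≡ b ∧ (c ≡ᵇ suc k)
    not-0-suc zero    b k = sym (∧-zeroʳ b)
    not-0-suc (suc c) b k = refl
    away-occurrences : ∀ k → k < a → countBelow m (awayInClique a (suc k)) ≡ q + ind (k <ᵇ s)
    away-occurrences k k<a = begin
        countBelow m (awayInClique a (suc k))
      ≡⟨ countBelow-cong m (λ x _ → not-0-suc (suc x % suc a) (a <ᵇ suc x) k) ⟩
        countBelow (suc m) (λ x → (a <ᵇ x) ∧ (x % suc a ≡ᵇ suc k))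
      ≡⟨ cong (λ t → countBelow t (λ x → (a <ᵇ x) ∧ (x % suc a ≡ᵇ suc k))) (+-assoc (suc a) (q * suc a) (suc s)) ⟩
        countBelow (suc a + (q * suc a + suc s)) (λ x → (a <ᵇ x) ∧ (x % suc a ≡ᵇ suc k))
      ≡⟨ beyond-first-period a (q * suc a + suc s) (suc k) ⟩
        countBelow (q * suc a + suc s) (λ x → x % suc a ≡ᵇ suc k)
      ≡⟨ residue-count a q (suc s) (suc k) (s≤s k<a) (s≤s s≤a) ⟩
        q + ind (k <ᵇ s) ∎
    containing-0 : prod (suc a) (λ k → suc (countBelow m (awayInClique a k))) ≡ (2 + q) ^ s * (1 + q) ^ (a ∸ s)
    containing-0 = begin
        suc (countBelow m (awayInClique a 0)) * prod a (λ k → suc (countBelow m (awayInClique a (suc k))))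
      ≡⟨ cong₂ _*_ (cong suc (trans (countBelow-cong m (λ x _ → not-0 (suc x % suc a) (a <ᵇ suc x))) (countBelow-false m)))
           (prod-cong a (λ k k<a → cong suc (away-occurrences k k<a))) ⟩
        1 * prod a (λ k → suc q + ind (k <ᵇ s))
      ≡⟨ trans (*-identityˡ _) (prod-balanced a s (suc q) s≤a) ⟩
        (2 + q) ^ s * (1 + q) ^ (a ∸ s) ∎

-- T_{s,s} has no edges.
fT-edgeless : ∀ s → fT s s ≡ 2 ^ s
fT-edgeless s = begin
    fT s s
  ≡⟨ cong (λ t → fT t s) (sym (trans (+-identityʳ (1 * s)) (*-identityˡ s))) ⟩
    fT (1 * s + 0) s
  ≡⟨ fT-formula s 1 0 z≤n ⟩
    1 * 2 ^ s
  ≡⟨ *-identityˡ (2 ^ s) ⟩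
    2 ^ s ∎
  where open ≡-Reasoning

division-shape : ∀ n a → suc a ≤ n ∸ 1 → Σ[ q ∈ ℕ ] Σ[ s ∈ ℕ ] s ≤ a × n ≡ suc q * suc a + suc s
division-shape (suc n₀) a α≤n₀
  with n₀ / suc a | m≡m%n+[m/n]*n n₀ (suc a) | m≥n⇒m/n>0 {n₀} {suc a} α≤n₀
... | suc q | n₀≡ | _ =
  q , n₀ % suc a , ≤-pred (m%n<n n₀ (suc a)) ,
  trans (cong suc (trans n₀≡ (+-comm (n₀ % suc a) (suc q * suc a)))) (sym (+-suc (suc q * suc a) (n₀ % suc a)))

ceilDiv-shape : ∀ q a s → s ≤ a → ceilDiv (suc q * suc a + suc s) (suc a) ≡ 2 + q
ceilDiv-shape q a s s≤a = begin
    (suc q * suc a + suc s + a) / suc a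
  ≡⟨ cong (_/ suc a) (regroup q a s) ⟩
    (s + (2 + q) * suc a) / suc a
  ≡⟨ +-distrib-/-∣ʳ s (n∣m*n (2 + q)) ⟩
    s / suc a + (2 + q) * suc a / suc a
  ≡⟨ cong₂ _+_ (m<n⇒m/n≡0 (s≤s s≤a)) (m*n/n≡m (2 + q) (suc a)) ⟩
    2 + q ∎
  where
    open ≡-Reasoning
    regroup : ∀ q a s → suc q * suc a + suc s + a ≡ s + (2 + q) * suc a
    regroup = solve-∀

n′-shape : ∀ q a s → s ≤ a →
  (suc q * suc a + suc s + 1) ∸ (ceilDiv (suc q * suc a + suc s) (suc a) + suc a) ≡ q * a + s
n′-shape q a s s≤a = begin
    (suc q * suc a + suc s + 1) ∸ (ceilDiv (suc q * suc a + suc s) (suc a) + suc a)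
  ≡⟨ cong₂ (λ t c → t ∸ (c + suc a)) (regroup q a s) (ceilDiv-shape q a s s≤a) ⟩
    ((2 + q) + suc a) + (q * a + s) ∸ ((2 + q) + suc a)
  ≡⟨ m+n∸m≡n ((2 + q) + suc a) (q * a + s) ⟩
    q * a + s ∎
  where
    open ≡-Reasoning
    regroup : ∀ q a s → suc q * suc a + suc s + 1 ≡ ((2 + q) + suc a) + (q * a + s)
    regroup = solve-∀

-- The case 2 ≤ α ≤ n - 2 of the lemma; the identity holds for every α ≥ 1.
fTC-general : ∀ q a s → s ≤ a →
  let n  = suc q * suc a + suc s
      n′ = (n + 1) ∸ (ceilDiv n (suc a) + suc a)
  in fTC n (suc a) ≡ fT (n ∸ 1) (suc a) + fT n′ (n′ ⊓ a)
fTC-general q a s s≤a = begin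
    fTC (suc q * suc a + suc s) (suc a)
  ≡⟨ fTC-formula q a s s≤a ⟩
    (2 + q) * ((3 + q) ^ s * (2 + q) ^ (a ∸ s)) + (2 + q) ^ s * (1 + q) ^ (a ∸ s)
  ≡⟨ cong₂ _+_ (sym turan-n-1) (sym (trans (cong (λ t → fT t (t ⊓ a)) (n′-shape q a s s≤a)) (reduced q))) ⟩
    fT (suc q * suc a + suc s ∸ 1) (suc a) + fT n′ (n′ ⊓ a) ∎
  where
    open ≡-Reasoning
    n′ : ℕ
    n′ = (suc q * suc a + suc s + 1) ∸ (ceilDiv (suc q * suc a + suc s) (suc a) + suc a)
    -- T_{n-1,α} has s cliques of size q+2 and α-s cliques of size q+1
    turan-n-1 : fT (suc q * suc a + suc s ∸ 1) (suc a) ≡ (2 + q) * ((3 + q) ^ s * (2 + q) ^ (a ∸ s))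
    turan-n-1 = begin
        fT (suc q * suc a + suc s ∸ 1) (suc a)
      ≡⟨ cong (λ t → fT (t ∸ 1) (suc a)) (+-suc (suc q * suc a) s) ⟩
        fT (suc q * suc a + s) (suc a)
      ≡⟨ fT-formula (suc a) (suc q) s (m≤n⇒m≤1+n s≤a) ⟩
        (3 + q) ^ s * (2 + q) ^ (suc a ∸ s)
      ≡⟨ cong (λ e → (3 + q) ^ s * (2 + q) ^ e) (+-∸-assoc 1 s≤a) ⟩
        (3 + q) ^ s * ((2 + q) * (2 + q) ^ (a ∸ s))
      ≡⟨ *-left-comm ((3 + q) ^ s) (2 + q) ((2 + q) ^ (a ∸ s)) ⟩
        (2 + q) * ((3 + q) ^ s * (2 + q) ^ (a ∸ s)) ∎
    -- T_{n',α'} with n' = q(α-1) + s: edgeless when q = 0, and otherwise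
    -- α' = α - 1 and the closed form applies
    reduced : ∀ q → fT (q * a + s) ((q * a + s) ⊓ a) ≡ (2 + q) ^ s * (1 + q) ^ (a ∸ s)
    reduced zero = begin
        fT s (s ⊓ a)
      ≡⟨ cong (fT s) (m≤n⇒m⊓n≡m s≤a) ⟩
        fT s s
      ≡⟨ fT-edgeless s ⟩
        2 ^ s
      ≡⟨ sym (trans (cong (2 ^ s *_) (^-zeroˡ (a ∸ s))) (*-identityʳ (2 ^ s))) ⟩
        2 ^ s * 1 ^ (a ∸ s) ∎
    reduced (suc p) = begin
        fT (suc p * a + s) ((suc p * a + s) ⊓ a)
      ≡⟨ cong (fT (suc p * a + s)) (m≥n⇒m⊓n≡n (≤-trans (m≤m+n a (p * a)) (m≤m+n (suc p * a) s))) ⟩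
        fT (suc p * a + s) a
      ≡⟨ fT-formula a (suc p) s s≤a ⟩
        (3 + p) ^ s * (2 + p) ^ (a ∸ s) ∎

-- The case α = 1: TC_{n,1} = T_{n,1} is the clique K_n.
fTC-one-clique : ∀ n → 1 ≤ n ∸ 1 → fTC n 1 ≡ n + 1
fTC-one-clique (suc (suc p)) _ = begin
    fTC (suc (suc p)) 1
  ≡⟨ cong (λ t → fTC t 1) (as-shape p) ⟩
    fTC (suc p * 1 + 1) 1
  ≡⟨ fTC-formula p 0 0 z≤n ⟩
    (2 + p) * (1 * 1) + 1 * 1
  ≡⟨ value p ⟩
    suc (suc p) + 1 ∎
  where
    open ≡-Reasoning
    as-shape : ∀ p → suc (suc p) ≡ suc p * 1 + 1
    as-shape = solve-∀
    value : ∀ p → (2 + p) * (1 * 1) + 1 * 1 ≡ suc (suc p) + 1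
    value = solve-∀

-- The case α = n - 1: TC_{α+1,α} is the star K_{1,α}.
fTC-star : ∀ n a → suc a ≡ n ∸ 1 → fTC n (suc a) ≡ 2 ^ (n ∸ 1) + 1
fTC-star (suc .(suc a)) a refl = begin
    fTC (2 + a) (suc a)
  ≡⟨ cong (λ t → fTC t (suc a)) (as-shape a) ⟩
    fTC (1 * suc a + 1) (suc a)
  ≡⟨ fTC-formula 0 a 0 z≤n ⟩
    2 * (1 * 2 ^ a) + 1 * 1 ^ a
  ≡⟨ cong₂ (λ u v → 2 * u + v) (*-identityˡ (2 ^ a)) (trans (*-identityˡ (1 ^ a)) (^-zeroˡ a)) ⟩
    2 ^ suc a + 1 ∎
  where
    open ≡-Reasoning
    as-shape : ∀ a → 2 + a ≡ 1 * suc a + 1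
    as-shape = solve-∀

lemma6 : (n α : ℕ) → 1 ≤ α → α ≤ n ∸ 1 →
    (α ≡ 1 → fTC n α ≡ n + 1) ×
    (α ≡ n ∸ 1 → fTC n α ≡ 2 ^ (n ∸ 1) + 1) ×
    (2 ≤ α → α ≤ n ∸ 2 →
      fTC n α ≡ fT (n ∸ 1) α + fT ((n + 1) ∸ (ceilDiv n α + α)) (((n + 1) ∸ (ceilDiv n α + α)) ⊓ (α ∸ 1)))
lemma6 n zero    () _
lemma6 n (suc a) _ α≤n-1 = (λ { refl → fTC-one-clique n α≤n-1 }) , fTC-star n a , λ _ _ → general
  where
    general : fTC n (suc a) ≡
      fT (n ∸ 1) (suc a) + fT ((n + 1) ∸ (ceilDiv n (suc a) + suc a)) (((n + 1) ∸ (ceilDiv n (suc a) + suc a)) ⊓ a)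
    general with division-shape n a α≤n-1
    ... | q , s , s≤a , refl = fTC-general q a s s≤a
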